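{- If $\mathbf{a},\mathbf{b}\in S_n$ with $\mathbf{a}\le_g\mathbf{b}$, then $\mathbf{a}\le_s\mathbf{b}$. Consequently, every strong up-set in $S_n$ is also a grid up-set.
   Context: Elements of $S_n$ are $n$-tuples $\mathbf{a}=(a_1,\dots,a_n)$ of distinct elements of $[n]$; $\mathrm{pos}(\mathbf{a},i)=k$ if $a_k=i$. For $1\le i<j\le n$, $\{i,j\}$ is an inversion of $\mathbf{a}$ if $\mathrm{pos}(\mathbf{a},i)>\mathrm{pos}(\mathbf{a},j)$. $\mathbf{a}\le_s\mathbf{b}$ (strong Bruhat order) means $\mathbf{b}$ can be reached from $\mathbf{a}$ by repeatedly swapping the two entries of an inversion. A strong up-set is a family closed under swapping the entries of an inversion. For $\mathbf{a}\in S_n$ define $\mathbf{f}(\mathbf{a})=(f_1,\dots,f_n)\in[1]\times[2]\times\cdots\times[n]$ by $f_j=|\{i\in[j]:\mathrm{pos}(\mathbf{a},i)\le\mathrm{pos}(\mathbf{a},j)\}|$. The grid order: $\mathbf{a}\le_g\mathbf{b}$ iff $\mathbf{f}(\mathbf{a})_i\le\mathbf{f}(\mathbf{b})_i$ for all $i$. A grid up-set is a family $\mathcal{A}$ such that $\mathbf{a}\in\mathcal{A}$ and $\mathbf{a}\le_g\mathbf{b}$ imply $\mathbf{b}\in\mathcal{A}$. -}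

module Defs where

open import Data.Nat using (ℕ)
open import Data.Fin using (Fin; _≤_; _<_)
open import Data.Fin.Properties using (_≤?_)
open import Data.Fin.Permutation using (Permutation′; _⟨$⟩ʳ_; _⟨$⟩ˡ_)
open import Data.Fin.Permutation.Components using (transpose)
open import Data.List using (List; length; filter; allFin)
open import Data.Product using (Σ; ∃; ∃-syntax; _×_; _,_)
open import Relation.Nullary.Decidable using (_×-dec_)
open import Relation.Binary.PropositionalEquality using (_≡_)

-- An element of S_n.  For a : S n,  a ⟨$⟩ʳ k  is the entry a_k (positions and
-- values are 0-indexed elements of Fin n, i.e. [n] shifted down by one).
S : ℕ → Set
S n = Permutation′ n

entry : ∀ {n} → S n → Fin n → Fin n
entry a k = a ⟨$⟩ʳ k

pos : ∀ {n} → S n → Fin n → Fin n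
pos a i = a ⟨$⟩ˡ i

_≋_ : ∀ {n} → S n → S n → Set
a ≋ b = ∀ k → entry a k ≡ entry b k

Inversion : ∀ {n} → S n → Fin n → Fin n → Set
Inversion a i j = (i < j) × (pos a j < pos a i)

SwapStep : ∀ {n} → S n → S n → Set
SwapStep {n} a b = ∃[ i ] ∃[ j ] (Inversion a i j × (∀ k → entry b k ≡ transpose i j (entry a k)))

data _≤s_ {n : ℕ} : S n → S n → Set where
  done : ∀ {a b} → a ≋ b → a ≤s b
  step : ∀ {a c b} → SwapStep a c → c ≤s b → a ≤s b

fvec : ∀ {n} → S n → Fin n → ℕ
fvec {n} a j = length (filter (λ i → (i ≤? j) ×-dec (pos a i ≤? pos a j)) (allFin n))

_≤g_ : ∀ {n} → S n → S n → Set
a ≤g b = ∀ j → fvec a j Data.Nat.≤ fvec b j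

-- strong up-set: closed under swapping the entries of an inversion
-- (and, as a predicate on S_n, respecting the equality ≋ of tuples)
StrongUpSet : ∀ {n} → (S n → Set) → Set
StrongUpSet {n} A = (∀ {a b} → a ≋ b → A a → A b) × (∀ {a b} → SwapStep a b → A a → A b)

GridUpSet : ∀ {n} → (S n → Set) → Set
GridUpSet {n} A = ∀ {a b} → A a → a ≤g b → A b

-- Suppose a ≤g b and a ≢ b.  Comparing a and b at the first position where
-- they differ shows that f(a)_j < f(b)_j for some value j (the other
-- inequality would contradict a ≤g b).  Then some value i < j sits after j in
-- a, since otherwise f(a)_j = j + 1 is already maximal.  Taking the first such
-- position after j, exchanging the values i and j raises f_j by exactly one and
-- leaves every other f_k unchanged.  The result a' is one strong step above a
-- and still satisfies a' ≤g b, while Σ_k (f(b)_k − f(a)_k) has decreased, so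
-- the process ends at b.
module Submission where

open import Defs
open import Level using (Level; 0ℓ)
open import Data.Bool.Base using (true; false; if_then_else_)
open import Data.Empty using (⊥-elim)
open import Data.Fin.Base using (Fin; zero; suc; _≤_; _<_; inject; fromℕ<)
open import Data.Fin.Permutation using (_∘ₚ_; inverseˡ; inverseʳ)
import Data.Fin.Permutation as Permutation
import Data.Fin.Permutation.Components as Components
open import Data.Fin.Properties
  using (_≟_; _≤?_; _<?_; <-cmp; ≤∧≢⇒<; <⇒≢; suc-injective; toℕ-injective; toℕ-inject; toℕ-fromℕ<;
         all?; any?; ¬∀⟶∃¬; ¬∀⟶∃¬-smallest)
open import Data.List.Base using (length; filter; tabulate)
open import Data.Nat.Base as ℕ using (ℕ; _+_; _∸_; z≤n; s≤s)
open import Data.Nat.Induction using (<-wellFounded)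
open import Data.Nat.Properties
  using (≤-refl; ≤-trans; ≤-antisym; <⇒≤; ≤-<-trans; ≮⇒≥; <⇒≱; m≤n⇒m≤1+n; n<1+n;
         +-mono-≤; +-mono-<-≤; +-mono-≤-<; ∸-monoʳ-≤; ∸-monoʳ-<)
open import Data.Product using (∃; ∃-syntax; _×_; _,_; proj₁; proj₂; swap)
open import Data.Sum using (_⊎_; inj₁; inj₂; [_,_]; map₁; map₂)
open import Function.Base using (_∘_; id)
open import Induction.WellFounded using (Acc; acc)
open import Relation.Binary.Definitions using (tri<; tri≈; tri>)
open import Relation.Binary.PropositionalEquality using (_≡_; _≢_; refl; sym; trans; cong; subst; subst₂)
open import Relation.Nullary using (yes; no; does; ¬_)
open import Relation.Nullary.Decidable using (_×-dec_; decidable-stable)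
open import Relation.Unary using (Pred; Decidable; _⊆_; _≐_; _∪_; _∩_; ∁; ｛_｝; _∈_; _∉_)
open import Relation.Unary.Properties using (≐-refl; _∪?_; _∩?_; ∁?)

private variable
  ℓ : Level
  n : ℕ
  A : Set

-- Counting over Fin n

count : {P : Pred (Fin n) ℓ} → Decidable P → ℕ
count {n = ℕ.zero} P? = 0
count {n = ℕ.suc n} P? = (if does (P? zero) then 1 else 0) + count (P? ∘ suc)

length-filter-tabulate : {P : Pred A ℓ} (P? : Decidable P) (g : Fin n → A) →
                         length (filter P? (tabulate g)) ≡ count (P? ∘ g)
length-filter-tabulate {n = ℕ.zero} P? g = refl
length-filter-tabulate {n = ℕ.suc n} P? g with does (P? (g zero))
... | true  = cong ℕ.suc (length-filter-tabulate P? (g ∘ suc))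
... | false = length-filter-tabulate P? (g ∘ suc)

count-mono : {P Q : Pred (Fin n) ℓ} (P? : Decidable P) (Q? : Decidable Q) →
             P ⊆ Q → count P? ℕ.≤ count Q?
count-mono {n = ℕ.zero} P? Q? P⊆Q = z≤n
count-mono {n = ℕ.suc n} P? Q? P⊆Q with P? zero | Q? zero | count-mono (P? ∘ suc) (Q? ∘ suc) P⊆Q
... | yes _ | yes _ | tail≤ = s≤s tail≤
... | yes p | no ¬q | _     = ⊥-elim (¬q (P⊆Q p))
... | no _  | yes _ | tail≤ = m≤n⇒m≤1+n tail≤
... | no _  | no _  | tail≤ = tail≤

count-cong : {P Q : Pred (Fin n) ℓ} (P? : Decidable P) (Q? : Decidable Q) →
             P ≐ Q → count P? ≡ count Q?
count-cong P? Q? (P⊆Q , Q⊆P) = ≤-antisym (count-mono P? Q? P⊆Q) (count-mono Q? P? Q⊆P)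

count-insert : {P Q : Pred (Fin n) ℓ} (P? : Decidable P) (Q? : Decidable Q) {m : Fin n} →
               m ∉ P → Q ≐ P ∪ ｛ m ｝ → count Q? ≡ ℕ.suc (count P?)
count-insert P? Q? {zero} m∉P (Q⊆ , ⊆Q) with P? zero | Q? zero
... | yes p | _     = ⊥-elim (m∉P p)
... | no _  | no ¬q = ⊥-elim (¬q (⊆Q (inj₂ refl)))
... | no _  | yes _ = cong ℕ.suc (count-cong (Q? ∘ suc) (P? ∘ suc) (tail ∘ Q⊆ , ⊆Q ∘ inj₁))
  where
  tail : ∀ {k} {X : Set ℓ} → X ⊎ zero ≡ suc k → X
  tail (inj₁ x) = x
count-insert P? Q? {suc m} m∉P (Q⊆ , ⊆Q) with P? zero | Q? zero
  | count-insert (P? ∘ suc) (Q? ∘ suc) m∉P (map₂ suc-injective ∘ Q⊆ , ⊆Q ∘ map₂ (cong suc))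
... | yes _ | yes _  | tail≡ = cong ℕ.suc tail≡
... | no _  | no _   | tail≡ = tail≡
... | yes p | no ¬q  | _     = ⊥-elim (¬q (⊆Q (inj₁ p)))
... | no ¬p | yes q  | _     with Q⊆ q
...   | inj₁ p = ⊥-elim (¬p p)

count-< : {P Q : Pred (Fin n) ℓ} (P? : Decidable P) (Q? : Decidable Q) {m : Fin n} →
          P ⊆ Q → m ∈ Q → m ∉ P → count P? ℕ.< count Q?
count-< {Q = Q} P? Q? {m} P⊆Q m∈Q m∉P =
  subst (ℕ._≤ count Q?) (count-insert P? P∪m? m∉P ≐-refl) (count-mono P∪m? Q? [ P⊆Q , m∈Q′ ])
  where
  P∪m? = P? ∪? (m ≟_)
  m∈Q′ : ∀ {k} → m ≡ k → k ∈ Q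
  m∈Q′ refl = m∈Q

count-exchange : {P Q : Pred (Fin n) ℓ} (P? : Decidable P) (Q? : Decidable Q) {u v : Fin n} →
                 u ∈ P → u ∉ Q → v ∈ Q → v ∉ P →
                 (∀ {l} → l ≢ u → l ≢ v → P l → Q l) →
                 (∀ {l} → l ≢ u → l ≢ v → Q l → P l) →
                 count P? ≡ count Q?
count-exchange {P = P} {Q} P? Q? {u} {v} u∈P u∉Q v∈Q v∉P P⇒Q Q⇒P =
  trans (count-insert P∩Q? P? (u∉Q ∘ proj₂) (split P⇒Q v∉P , joinˡ))
        (sym (count-insert P∩Q? Q? (v∉P ∘ proj₁) (map₁ swap ∘ split (λ l≢v l≢u → Q⇒P l≢u l≢v) u∉Q , joinʳ)))
  where
  P∩Q? = P? ∩? Q?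
  split : ∀ {X Y : Pred (Fin n) ℓ} {x y} → (∀ {l} → l ≢ x → l ≢ y → X l → Y l) → y ∉ X →
          X ⊆ (X ∩ Y) ∪ ｛ x ｝
  split {x = x} {y} X⇒Y y∉X {l} Xl with x ≟ l | y ≟ l
  ... | yes x≡l | _        = inj₂ x≡l
  ... | no _    | yes refl = ⊥-elim (y∉X Xl)
  ... | no x≢l  | no y≢l   = inj₁ (Xl , X⇒Y (x≢l ∘ sym) (y≢l ∘ sym) Xl)
  joinˡ : (P ∩ Q) ∪ ｛ u ｝ ⊆ P
  joinˡ (inj₁ (Pl , _)) = Pl
  joinˡ (inj₂ refl)     = u∈P
  joinʳ : (P ∩ Q) ∪ ｛ v ｝ ⊆ Q
  joinʳ (inj₁ (_ , Ql)) = Ql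
  joinʳ (inj₂ refl)     = v∈Q

sum : (Fin n → ℕ) → ℕ
sum {n = ℕ.zero} f = 0
sum {n = ℕ.suc n} f = f zero + sum (f ∘ suc)

sum-mono-≤ : {f g : Fin n → ℕ} → (∀ k → f k ℕ.≤ g k) → sum f ℕ.≤ sum g
sum-mono-≤ {n = ℕ.zero} f≤g = z≤n
sum-mono-≤ {n = ℕ.suc n} f≤g = +-mono-≤ (f≤g zero) (sum-mono-≤ (f≤g ∘ suc))

sum-mono-< : {f g : Fin n → ℕ} → (∀ k → f k ℕ.≤ g k) → (m : Fin n) → f m ℕ.< g m → sum f ℕ.< sum g
sum-mono-< f≤g zero    fm<gm = +-mono-<-≤ fm<gm (sum-mono-≤ (f≤g ∘ suc))
sum-mono-< f≤g (suc m) fm<gm = +-mono-≤-< (f≤g zero) (sum-mono-< (f≤g ∘ suc) m fm<gm)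

∃-least : {P : Pred (Fin n) ℓ} → Decidable P → ∃ P →
          ∃ λ i → P i × (∀ {j} → j < i → j ∉ P)
∃-least {n = n} {P = P} P? (i , Pi) with ¬∀⟶∃¬-smallest n (∁ P) (∁? P?) (λ ∀¬P → ∀¬P i Pi)
... | m , ¬¬Pm , below =
  m , decidable-stable (P? m) ¬¬Pm , λ j<m → subst (∁ P) (inject-fromℕ< j<m) (below (fromℕ< j<m))
  where
  inject-fromℕ< : ∀ {j} (j<m : j < m) → inject (fromℕ< j<m) ≡ j
  inject-fromℕ< j<m = toℕ-injective (trans (toℕ-inject (fromℕ< j<m)) (toℕ-fromℕ< j<m))

-- Positions and first differences

pos-entry : (a : S n) (k : Fin n) → pos a (entry a k) ≡ k
pos-entry a _ = inverseˡ a

entry-pos : (a : S n) (v : Fin n) → entry a (pos a v) ≡ v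
entry-pos a _ = inverseʳ a

pos-injective : (a : S n) {u v : Fin n} → pos a u ≡ pos a v → u ≡ v
pos-injective a {u} {v} eq = trans (sym (entry-pos a u)) (trans (cong (entry a) eq) (entry-pos a v))

agree-below : (a b : S n) {p : Fin n} → (∀ {r} → r < p → entry a r ≡ entry b r) →
              ∀ {l} → pos a l < p → pos b l ≡ pos a l
agree-below a b same {l} l-before =
  trans (cong (pos b) (trans (sym (entry-pos a l)) (same l-before))) (pos-entry b (pos a l))

transpose-matchˡ : (i j : Fin n) → Components.transpose i j i ≡ j
transpose-matchˡ i j with i ≟ i
... | yes _  = refl
... | no i≢i = ⊥-elim (i≢i refl)

transpose-matchʳ : (i j : Fin n) → Components.transpose i j j ≡ i
transpose-matchʳ i j with j ≟ i
... | yes refl = refl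
... | no _ with j ≟ j
...   | yes _  = refl
...   | no j≢j = ⊥-elim (j≢j refl)

transpose-mismatch : {i j k : Fin n} → k ≢ i → k ≢ j → Components.transpose i j k ≡ k
transpose-mismatch {i = i} {j} {k} k≢i k≢j with k ≟ i
... | yes k≡i = ⊥-elim (k≢i k≡i)
... | no _ with k ≟ j
...   | yes k≡j = ⊥-elim (k≢j k≡j)
...   | no _    = refl

swap-values : S n → Fin n → Fin n → S n
swap-values a i j = a ∘ₚ Permutation.transpose i j

Counts : S n → Fin n → Pred (Fin n) 0ℓ
Counts a j l = l ≤ j × pos a l ≤ pos a j

counts? : (a : S n) (j : Fin n) → Decidable (Counts a j)
counts? a j l = (l ≤? j) ×-dec (pos a l ≤? pos a j)

fvec≡count : (a : S n) (j : Fin n) → fvec a j ≡ count (counts? a j)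
fvec≡count a j = length-filter-tabulate (counts? a j) id

fvec-<-at-first-difference :
  (a b : S n) (p : Fin n) → (∀ {r} → r < p → entry a r ≡ entry b r) →
  entry b p < entry a p → fvec a (entry a p) ℕ.< fvec b (entry a p)
fvec-<-at-first-difference a b p same y<x
  rewrite fvec≡count a (entry a p) | fvec≡count b (entry a p) =
  count-< (counts? a x) (counts? b x) a⊆b (<⇒≤ y<x , y-at-p≤) y∉a
  where
  x = entry a p
  y = entry b p
  p≤pos-b-x : p ≤ pos b x
  p≤pos-b-x = ≮⇒≥ λ before →
    <⇒≢ before (trans (sym (agree-below b a (sym ∘ same) before)) (pos-entry a p))
  y-at-p≤ : pos b y ≤ pos b x
  y-at-p≤ = subst (_≤ pos b x) (sym (pos-entry b p)) p≤pos-b-x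
  a⊆b : Counts a x ⊆ Counts b x
  a⊆b {l} (l≤x , at-or-before) with <-cmp (pos a l) p
  ... | tri< before _ _ = l≤x , ≤-trans (subst (_≤ p) (sym (agree-below a b same before)) (<⇒≤ before)) p≤pos-b-x
  ... | tri≈ _ at _     = subst (Counts b x) (sym (pos-injective a (trans at (sym (pos-entry a p))))) (≤-refl , ≤-refl)
  ... | tri> _ _ after  = ⊥-elim (<⇒≱ after (subst (pos a l ≤_) (pos-entry a p) at-or-before))
  y∉a : y ∉ Counts a x
  y∉a (_ , at-or-before) with <-cmp (pos a y) p
  ... | tri< before _ _ = <⇒≢ before (trans (sym (agree-below a b same before)) (pos-entry b p))
  ... | tri≈ _ at _     = <⇒≢ y<x (pos-injective a (trans at (sym (pos-entry a p))))
  ... | tri> _ _ after  = <⇒≱ after (subst (pos a y ≤_) (pos-entry a p) at-or-before)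

first-difference : (a b : S n) → ¬ a ≋ b →
                   ∃[ p ] entry a p ≢ entry b p × (∀ {r} → r < p → entry a r ≡ entry b r)
first-difference {n = n} a b a≢b =
  let p , differ , below = ∃-least (∁? agree?) (¬∀⟶∃¬ n _ agree? a≢b)
  in  p , differ , λ r<p → decidable-stable (agree? _) (below r<p)
  where
  agree? : Decidable (λ r → entry a r ≡ entry b r)
  agree? r = entry a r ≟ entry b r

≤g⇒≋⊎fvec-< : (a b : S n) → a ≤g b → a ≋ b ⊎ ∃[ j ] fvec a j ℕ.< fvec b j
≤g⇒≋⊎fvec-< a b a≤b with all? (λ r → entry a r ≟ entry b r)
... | yes a≋b = inj₁ a≋b
... | no a≢b with first-difference a b a≢b
...   | p , differ , same with <-cmp (entry b p) (entry a p)
...     | tri< y<x _ _ = inj₂ (entry a p , fvec-<-at-first-difference a b p same y<x)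
...     | tri≈ _ y≡x _ = ⊥-elim (differ (sym y≡x))
...     | tri> _ _ x<y = ⊥-elim (<⇒≱ (fvec-<-at-first-difference b a p (sym ∘ same) x<y) (a≤b (entry b p)))

-- Exchanging two values

module Exchange {n : ℕ} (a a′ : S n) {i j : Fin n} (i<j : i < j) (j-before-i : pos a j < pos a i)
  (gap : ∀ {l} → l < j → pos a l < pos a i → pos a l ≤ pos a j)
  (pos′-i : pos a′ i ≡ pos a j) (pos′-j : pos a′ j ≡ pos a i)
  (pos′-other : ∀ {l} → l ≢ i → l ≢ j → pos a′ l ≡ pos a l)
  where

  data Role : Fin n → Set where
    is-i  : Role i
    is-j  : Role j
    other : ∀ {l} → l ≢ i → l ≢ j → Role l

  role : ∀ l → Role l
  role l with l ≟ i | l ≟ j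
  ... | yes refl | _        = is-i
  ... | no _     | yes refl = is-j
  ... | no l≢i   | no l≢j   = other l≢i l≢j

  p≤q : pos a j ≤ pos a i
  p≤q = <⇒≤ j-before-i

  squeeze : ∀ {l} → l < j → l ≢ i → pos a l ≤ pos a i → pos a l ≤ pos a j
  squeeze l<j l≢i l≤q = gap l<j (≤∧≢⇒< l≤q (l≢i ∘ pos-injective a))

  fvec-raised : fvec a′ j ≡ ℕ.suc (fvec a j)
  fvec-raised rewrite fvec≡count a′ j | fvec≡count a j =
    count-insert (counts? a j) (counts? a′ j) i∉ (to , from)
    where
    i∉ : i ∉ Counts a j
    i∉ (_ , q≤p) = <⇒≱ j-before-i q≤p
    to : Counts a′ j ⊆ Counts a j ∪ ｛ i ｝
    to {l} (l≤j , l≤′j) with role l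
    ... | is-i          = inj₂ refl
    ... | is-j          = inj₁ (≤-refl , ≤-refl)
    ... | other l≢i l≢j =
      inj₁ (l≤j , squeeze (≤∧≢⇒< l≤j l≢j) l≢i (subst₂ _≤_ (pos′-other l≢i l≢j) pos′-j l≤′j))
    from : Counts a j ∪ ｛ i ｝ ⊆ Counts a′ j
    from (inj₂ refl) = <⇒≤ i<j , subst₂ _≤_ (sym pos′-i) (sym pos′-j) p≤q
    from {l} (inj₁ (l≤j , l≤p)) with role l
    ... | is-i          = ⊥-elim (i∉ (l≤j , l≤p))
    ... | is-j          = ≤-refl , ≤-refl
    ... | other l≢i l≢j = l≤j , subst₂ _≤_ (sym (pos′-other l≢i l≢j)) (sym pos′-j) (≤-trans l≤p p≤q)

  fvec-i : fvec a′ i ≡ fvec a i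
  fvec-i rewrite fvec≡count a′ i | fvec≡count a i = count-cong (counts? a′ i) (counts? a i) (to , from)
    where
    to : Counts a′ i ⊆ Counts a i
    to {l} (l≤i , l≤′i) with role l
    ... | is-i          = ≤-refl , ≤-refl
    ... | is-j          = ⊥-elim (<⇒≱ i<j l≤i)
    ... | other l≢i l≢j = l≤i , ≤-trans (subst₂ _≤_ (pos′-other l≢i l≢j) pos′-i l≤′i) p≤q
    from : Counts a i ⊆ Counts a′ i
    from {l} (l≤i , l≤q) with role l
    ... | is-i          = ≤-refl , ≤-refl
    ... | is-j          = ⊥-elim (<⇒≱ i<j l≤i)
    ... | other l≢i l≢j =
      l≤i , subst₂ _≤_ (sym (pos′-other l≢i l≢j)) (sym pos′-i) (squeeze (≤-<-trans l≤i i<j) l≢i l≤q)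

  module Unmoved {k : Fin n} (k≢i : k ≢ i) (k≢j : k ≢ j) where

    pos′-k : pos a′ k ≡ pos a k
    pos′-k = pos′-other k≢i k≢j

    counts-other : ∀ {l} → l ≢ i → l ≢ j → Counts a′ k l → Counts a k l
    counts-other l≢i l≢j (l≤k , l≤′k) = l≤k , subst₂ _≤_ (pos′-other l≢i l≢j) pos′-k l≤′k

    counts′-other : ∀ {l} → l ≢ i → l ≢ j → Counts a k l → Counts a′ k l
    counts′-other l≢i l≢j (l≤k , l≤r) = l≤k , subst₂ _≤_ (sym (pos′-other l≢i l≢j)) (sym pos′-k) l≤r

    fvec-outside : ¬ (pos a j < pos a k × pos a k < pos a i) → fvec a′ k ≡ fvec a k
    fvec-outside outside rewrite fvec≡count a′ k | fvec≡count a k =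
      count-cong (counts? a′ k) (counts? a k) (to , from)
      where
      p≤r⇒q≤r : pos a j ≤ pos a k → pos a i ≤ pos a k
      p≤r⇒q≤r p≤r = ≮⇒≥ λ r<q → outside (≤∧≢⇒< p≤r (k≢j ∘ sym ∘ pos-injective a) , r<q)
      q≤r⇒p≤r : pos a i ≤ pos a k → pos a j ≤ pos a k
      q≤r⇒p≤r = ≤-trans p≤q
      to : Counts a′ k ⊆ Counts a k
      to {l} (l≤k , l≤′k) with role l
      ... | is-i          = l≤k , p≤r⇒q≤r (subst₂ _≤_ pos′-i pos′-k l≤′k)
      ... | is-j          = l≤k , q≤r⇒p≤r (subst₂ _≤_ pos′-j pos′-k l≤′k)
      ... | other l≢i l≢j = counts-other l≢i l≢j (l≤k , l≤′k)
      from : Counts a k ⊆ Counts a′ k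
      from {l} (l≤k , l≤r) with role l
      ... | is-i          = l≤k , subst₂ _≤_ (sym pos′-i) (sym pos′-k) (q≤r⇒p≤r l≤r)
      ... | is-j          = l≤k , subst₂ _≤_ (sym pos′-j) (sym pos′-k) (p≤r⇒q≤r l≤r)
      ... | other l≢i l≢j = counts′-other l≢i l≢j (l≤k , l≤r)

    fvec-between : pos a j < pos a k → pos a k < pos a i → fvec a′ k ≡ fvec a k
    fvec-between p<r r<q rewrite fvec≡count a′ k | fvec≡count a k =
      count-exchange (counts? a′ k) (counts? a k) {i} {j}
        (≤-trans (<⇒≤ i<j) j≤k , subst₂ _≤_ (sym pos′-i) (sym pos′-k) (<⇒≤ p<r))
        (λ (_ , q≤r) → <⇒≱ r<q q≤r)
        (j≤k , <⇒≤ p<r)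
        (λ (_ , q≤′r) → <⇒≱ r<q (subst₂ _≤_ pos′-j pos′-k q≤′r))
        (λ l≢i l≢j → counts-other l≢i l≢j)
        (λ l≢i l≢j → counts′-other l≢i l≢j)
      where
      j≤k : j ≤ k
      j≤k = ≮⇒≥ λ k<j → <⇒≱ p<r (gap k<j r<q)

  fvec-fixed : ∀ {k} → k ≢ j → fvec a′ k ≡ fvec a k
  fvec-fixed {k} k≢j with role k
  ... | is-i = fvec-i
  ... | is-j = ⊥-elim (k≢j refl)
  ... | other k≢i _ with (pos a j <? pos a k) ×-dec (pos a k <? pos a i)
  ...   | yes (p<r , r<q) = Unmoved.fvec-between k≢i k≢j p<r r<q
  ...   | no outside      = Unmoved.fvec-outside k≢i k≢j outside

record Raises (a a′ : S n) (j : Fin n) : Set where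
  constructor raises
  field
    raised : fvec a′ j ≡ ℕ.suc (fvec a j)
    fixed  : ∀ {k} → k ≢ j → fvec a′ k ≡ fvec a k

SmallerAfter : S n → Fin n → Pred (Fin n) 0ℓ
SmallerAfter a j r = pos a j < r × entry a r < j

smallerAfter? : (a : S n) (j : Fin n) → Decidable (SmallerAfter a j)
smallerAfter? a j r = (pos a j <? r) ×-dec (entry a r <? j)

smallerAfter⇒raising-step : (a : S n) {j : Fin n} → ∃ (SmallerAfter a j) →
                            ∃[ a′ ] SwapStep a a′ × Raises a a′ j
smallerAfter⇒raising-step a {j} found with ∃-least (smallerAfter? a j) found
... | q , (j-before-q , i<j) , earliest =
  a′ , (i , j , (i<j , j-before-i) , λ _ → refl) , raises fvec-raised fvec-fixed
  where
  i = entry a q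
  a′ = swap-values a i j
  j-before-i : pos a j < pos a i
  j-before-i = subst (pos a j <_) (sym (pos-entry a q)) j-before-q
  gap : ∀ {m} → m < j → pos a m < pos a i → pos a m ≤ pos a j
  gap {m} m<j m-before-i = ≮⇒≥ λ j-before-m →
    earliest (subst (pos a m <_) (pos-entry a q) m-before-i)
             (j-before-m , subst (_< j) (sym (entry-pos a m)) m<j)
  open Exchange a a′ i<j j-before-i gap
    (cong (pos a) (transpose-matchʳ j i)) (cong (pos a) (transpose-matchˡ j i))
    (λ m≢i m≢j → cong (pos a) (transpose-mismatch m≢j m≢i))

fvec≤-if-smaller-before : (a b : S n) {j : Fin n} → (∀ {l} → l < j → pos a l < pos a j) →
                          fvec b j ℕ.≤ fvec a j
fvec≤-if-smaller-before a b {j} smaller-before rewrite fvec≡count b j | fvec≡count a j =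
  count-mono (counts? b j) (counts? a j) b⊆a
  where
  b⊆a : Counts b j ⊆ Counts a j
  b⊆a {l} (l≤j , _) with l ≟ j
  ... | yes refl = l≤j , ≤-refl
  ... | no l≢j   = l≤j , <⇒≤ (smaller-before (≤∧≢⇒< l≤j l≢j))

fvec-<⇒smallerAfter : (a b : S n) {j : Fin n} → fvec a j ℕ.< fvec b j → ∃ (SmallerAfter a j)
fvec-<⇒smallerAfter a b {j} fa<fb with any? (smallerAfter? a j)
... | yes found = found
... | no none   = ⊥-elim (<⇒≱ fa<fb (fvec≤-if-smaller-before a b smaller-before))
  where
  smaller-before : ∀ {l} → l < j → pos a l < pos a j
  smaller-before {l} l<j = ≤∧≢⇒< (≮⇒≥ λ j-before-l → none (pos a l , j-before-l , l<j′)) (<⇒≢ l<j ∘ pos-injective a)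
    where
    l<j′ : entry a (pos a l) < j
    l<j′ = subst (_< j) (sym (entry-pos a l)) l<j

-- From the grid order to the strong order

deficit : S n → S n → ℕ
deficit b a = sum (λ k → fvec b k ∸ fvec a k)

module _ {a a′ b : S n} {j : Fin n} (fa<fb : fvec a j ℕ.< fvec b j) (a-raises : Raises a a′ j) where

  open Raises a-raises

  raise-≤g : a ≤g b → a′ ≤g b
  raise-≤g a≤b k with k ≟ j
  ... | yes refl = subst (ℕ._≤ fvec b j) (sym raised) fa<fb
  ... | no k≢j   = subst (ℕ._≤ fvec b k) (sym (fixed k≢j)) (a≤b k)

  raise-deficit : deficit b a′ ℕ.< deficit b a
  raise-deficit = sum-mono-< (λ k → ∸-monoʳ-≤ (fvec b k) (fa≤fa′ k)) j
    (subst (λ f → fvec b j ∸ f ℕ.< fvec b j ∸ fvec a j) (sym raised) (∸-monoʳ-< (n<1+n _) fa<fb))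
    where
    fa≤fa′ : ∀ k → fvec a k ℕ.≤ fvec a′ k
    fa≤fa′ k with k ≟ j
    ... | yes refl = subst (fvec a j ℕ.≤_) (sym raised) (m≤n⇒m≤1+n ≤-refl)
    ... | no k≢j   = subst (fvec a k ℕ.≤_) (sym (fixed k≢j)) ≤-refl

≤g⇒≤s : {a b : S n} → a ≤g b → a ≤s b
≤g⇒≤s {a = a} {b} = go a (<-wellFounded (deficit b a))
  where
  go : ∀ a → Acc ℕ._<_ (deficit b a) → a ≤g b → a ≤s b
  go a (acc smaller) a≤b with ≤g⇒≋⊎fvec-< a b a≤b
  ... | inj₁ a≋b = done a≋b
  ... | inj₂ (j , fa<fb) with smallerAfter⇒raising-step a (fvec-<⇒smallerAfter a b fa<fb)
  ...   | a′ , a→a′ , a′-raises =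
    step a→a′ (go a′ (smaller (raise-deficit {b = b} fa<fb a′-raises)) (raise-≤g {b = b} fa<fb a′-raises a≤b))

strongUpSet-≤s : {A : S n → Set} → StrongUpSet A → {a b : S n} → a ≤s b → A a → A b
strongUpSet-≤s (respects-≋ , respects-swap) (done a≋b)  = respects-≋ a≋b
strongUpSet-≤s up@(_ , respects-swap) (step a→c c≤b) = strongUpSet-≤s up c≤b ∘ respects-swap a→c

lemma3 : (n : ℕ) →
    ((a b : S n) → a ≤g b → a ≤s b) ×
    ((A : S n → Set) → StrongUpSet A → GridUpSet A)
lemma3 n = (λ _ _ → ≤g⇒≤s) , λ A up Aa a≤b → strongUpSet-≤s up (≤g⇒≤s a≤b) Aa
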